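{- Let $\Gamma$ be a 2-colored best match graph (2-cBMG). Let $\bar V$ be the set of vertices of $\Gamma$ that are endpoints of at least two symmetric edges of $\Gamma$, and let $\Sigma$ be the undirected graph with vertex set $\bar V$ in which $\bar u\bar v$ is an edge if and only if $\{\bar u,\bar v\}$ is a symmetric edge of $\Gamma$. Then every connected component of $\Sigma$ is a complete bipartite graph.
   Context: Digraphs have no loops or multiple edges; $N(x)$, $N^-(x)$ are out- and in-neighbourhoods, $N(S)=\bigcup_{s\in S}N(s)$. A 2-cBMG is a bipartite digraph (two colour classes, every edge joining different classes), not necessarily connected, satisfying: N1: for any vertices $x,y$ with $x\notin N(y)$, $y\notin N(x)$, $N(x)\cap N(N(y))=N(y)\cap N(N(x))=\emptyset$; N2: $N(N(N(x)))\subseteq N(x)$ for all $x$; N3: for any vertices $x,y$ with $x\notin N(N(y))$, $y\notin N(N(x))$ and $N(x)\cap N(y)\neq\emptyset$, $N^-(x)=N^-(y)$ and $N(x)\subseteq N(y)$ or $N(y)\subseteq N(x)$; N4: every vertex has an out-neighbour. A symmetric edge is a pair $\{x,y\}$ with both $xy$ and $yx$ edges. -}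

module Defs where

open import Data.Nat using (ℕ)
open import Data.Fin using (Fin)
open import Data.Bool using (Bool; true)
open import Data.Product using (Σ; ∃; _×_; _,_)
open import Data.Sum using (_⊎_)
open import Relation.Nullary using (¬_)
open import Relation.Binary.PropositionalEquality using (_≡_; _≢_)
open import Function.Bundles using (_⇔_)

record Digraph (n : ℕ) : Set where
  field
    adj : Fin n → Fin n → Bool

module _ {n : ℕ} (G : Digraph n) where
  open Digraph G

  Arc : Fin n → Fin n → Set
  Arc x y = adj x y ≡ true

  Arc2 : Fin n → Fin n → Set
  Arc2 x y = ∃ λ w → Arc x w × Arc w y

  NoLoops : Set
  NoLoops = ∀ x → ¬ Arc x x

  Bipartite : Set
  Bipartite = Σ (Fin n → Bool) λ col → ∀ x y → Arc x y → col x ≢ col y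

  N1 : Set
  N1 = ∀ x y → ¬ Arc y x → ¬ Arc x y →
       (∀ z → ¬ (Arc x z × Arc2 y z)) × (∀ z → ¬ (Arc y z × Arc2 x z))

  N2 : Set
  N2 = ∀ x a b c → Arc x a → Arc a b → Arc b c → Arc x c

  N3 : Set
  N3 = ∀ x y → ¬ Arc2 y x → ¬ Arc2 x y → (∃ λ z → Arc x z × Arc y z) →
       (∀ z → Arc z x ⇔ Arc z y) ×
       ((∀ z → Arc x z → Arc y z) ⊎ (∀ z → Arc y z → Arc x z))

  N4 : Set
  N4 = ∀ x → ∃ λ y → Arc x y

  -- 2-coloured best match graph (2-cBMG), not necessarily connected
  Is2cBMG : Set
  Is2cBMG = NoLoops × Bipartite × N1 × N2 × N3 × N4

  SymEdge : Fin n → Fin n → Set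
  SymEdge x y = Arc x y × Arc y x

  InVbar : Fin n → Set
  InVbar x = ∃ λ y → ∃ λ z → y ≢ z × SymEdge x y × SymEdge x z

  -- Reachability in Σ (the undirected graph on V̄ whose edges are the
  -- symmetric edges of Γ between vertices of V̄).
  data ReachΣ (u : Fin n) : Fin n → Set where
    here : InVbar u → ReachΣ u u
    step : ∀ {v w} → ReachΣ u v → SymEdge v w → InVbar w → ReachΣ u w

  ComponentCompleteBipartite : Fin n → Set
  ComponentCompleteBipartite u =
    Σ (Fin n → Bool) λ part →
      ∀ x y → ReachΣ u x → ReachΣ u y → (SymEdge x y ⇔ (part x ≢ part y))

-- Only N2 and the 2-colouring matter.  By N2, a path a – b – c – d of
-- symmetric edges closes to a symmetric edge a – d.  Walking along symmetric
-- edges from u, every vertex of u's colour stays a symmetric neighbour of all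
-- symmetric neighbours of u, and every vertex of the other colour stays a
-- symmetric neighbour of u itself (here one symmetric neighbour t of u is
-- needed to pass through).  Hence any two differently coloured vertices of
-- the component are symmetric neighbours, and the colour classes are the two
-- sides of the complete bipartite graph.
module Submission where

open import Defs
open import Data.Nat using (ℕ)
open import Data.Fin using (Fin)
open import Data.Bool using (Bool)
open import Data.Bool.Properties using (¬-not) renaming (_≟_ to _≟ᵇ_)
open import Data.Product using (_×_; _,_)
open import Function using (_∘_)
open import Function.Bundles using (mk⇔)
open import Relation.Nullary using (yes; no; contradiction)
open import Relation.Binary.PropositionalEquality using (_≡_; _≢_; refl; sym; trans)

≢-≢⇒≡ : ∀ {a b c : Bool} → a ≢ b → b ≢ c → a ≡ c
≢-≢⇒≡ a≢b b≢c = trans (¬-not a≢b) (sym (¬-not (b≢c ∘ sym)))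

module _ {n : ℕ} (Γ : Digraph n) where

  SymEdge-sym : ∀ {x y} → SymEdge Γ x y → SymEdge Γ y x
  SymEdge-sym (xy , yx) = yx , xy

  N2⇒SymEdge-trans₃ : N2 Γ → ∀ {a b c d} →
    SymEdge Γ a b → SymEdge Γ b c → SymEdge Γ c d → SymEdge Γ a d
  N2⇒SymEdge-trans₃ n2 (ab , ba) (bc , cb) (cd , dc) =
    n2 _ _ _ _ ab bc cd , n2 _ _ _ _ dc cb ba

module _ {n : ℕ} (Γ : Digraph n) (n2 : N2 Γ) (col : Fin n → Bool)
         (proper : ∀ x y → Arc Γ x y → col x ≢ col y) where

  private
    trans₃ : ∀ {a b c d} →
      SymEdge Γ a b → SymEdge Γ b c → SymEdge Γ c d → SymEdge Γ a d
    trans₃ = N2⇒SymEdge-trans₃ Γ n2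

    symEdge-col : ∀ {x y} → SymEdge Γ x y → col x ≢ col y
    symEdge-col {x} {y} (xy , _) = proper x y xy

  module _ {u t : Fin n} (ut : SymEdge Γ u t) where

    SameSide : Fin n → Set
    SameSide x = col x ≡ col u → ∀ z → SymEdge Γ z u → SymEdge Γ z x

    OtherSide : Fin n → Set
    OtherSide x = col x ≢ col u → SymEdge Γ u x

    reach⇒sides : ∀ {x} → ReachΣ Γ u x → SameSide x × OtherSide x
    reach⇒sides (here _) = (λ _ _ zu → zu) , (λ u≢u → contradiction refl u≢u)
    reach⇒sides {w} (step {v} r vw _) with reach⇒sides r | col w ≟ᵇ col u
    ... | _ , otherᵥ | yes w≡u =
      (λ _ z zu → trans₃ zu (otherᵥ v≢u) vw) , (λ w≢u → contradiction w≡u w≢u)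
      where
      v≢u : col v ≢ col u
      v≢u v≡u = symEdge-col vw (trans v≡u (sym w≡u))
    ... | sameᵥ , _ | no w≢u =
      (λ w≡u → contradiction w≡u w≢u) ,
      (λ _ → trans₃ ut (sameᵥ (≢-≢⇒≡ (symEdge-col vw) w≢u) t (SymEdge-sym Γ ut)) vw)

    reach⇒SymEdge : ∀ {x y} → ReachΣ Γ u x → ReachΣ Γ u y →
      col x ≢ col y → SymEdge Γ x y
    reach⇒SymEdge {x} {y} rx ry x≢y
      with reach⇒sides rx | reach⇒sides ry | col x ≟ᵇ col u
    ... | sameₓ , _ | _ , otherᵧ | yes x≡u =
      SymEdge-sym Γ (sameₓ x≡u y (SymEdge-sym Γ (otherᵧ (x≢y ∘ trans x≡u ∘ sym))))
    ... | _ , otherₓ | sameᵧ , _ | no x≢u =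
      sameᵧ (≢-≢⇒≡ (x≢y ∘ sym) x≢u) x (SymEdge-sym Γ (otherₓ x≢u))

proposition8 : (n : ℕ) (Γ : Digraph n) → Is2cBMG Γ →
    ∀ u → InVbar Γ u → ComponentCompleteBipartite Γ u
proposition8 n Γ (_ , (col , proper) , _ , n2 , _) u (_ , _ , _ , ut , _) =
  col , λ x y rx ry →
    mk⇔ (λ (xy , _) → proper x y xy) (reach⇒SymEdge Γ n2 col proper ut rx ry)
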